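{- Let $T$ be a tree of order $n \ge 4$ with $\operatorname{diam}(T) = 3$. Then $\gamma(M(T)) = n-2$.
   Context: $\operatorname{diam}(T)$ is the maximum, over all pairs of vertices, of the distance (length of a shortest path) between them. For a finite simple graph $G$, the middle graph $M(G)$ is the graph with vertex set $V(G)\cup E(G)$ in which two elements $x,y$ are adjacent if and only if either (1) $x,y\in E(G)$ and the edges $x,y$ share a common endpoint in $G$, or (2) $x\in V(G)$, $y\in E(G)$ and $x$ is an endpoint of $y$ (or vice versa). A dominating set of a graph $H$ is a set $S\subseteq V(H)$ such that every vertex of $H$ is in $S$ or adjacent to a vertex of $S$; the domination number $\gamma(H)$ is the minimum cardinality of a dominating set of $H$. -}

module Defs where

open import Data.Nat using (ℕ; zero; suc; _≤_; _+_)
open import Data.Fin using (Fin; _<_)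
open import Data.Bool using (Bool; true)
open import Data.Product using (Σ; _×_; _,_; ∃; ∃-syntax)
open import Data.Sum using (_⊎_; inj₁; inj₂)
open import Data.List using (List; []; _∷_; length)
open import Data.List.Membership.Propositional using (_∈_)
open import Data.List.Relation.Unary.Unique.Propositional using (Unique)
open import Data.List.Relation.Unary.Any using (Any)
open import Relation.Binary.PropositionalEquality using (_≡_; _≢_)
open import Data.Empty using (⊥)
open import Relation.Nullary using (¬_)

record Graph (n : ℕ) : Set where
  field
    adj   : Fin n → Fin n → Bool
    sym   : ∀ u v → adj u v ≡ true → adj v u ≡ true
    irrefl : ∀ u → ¬ (adj u u ≡ true)
open Graph public

Adj : ∀ {n} → Graph n → Fin n → Fin n → Set
Adj G u v = adj G u v ≡ true

data Walk {n : ℕ} (G : Graph n) : Fin n → Fin n → ℕ → Set where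
  here : ∀ {u} → Walk G u u 0
  step : ∀ {u w v k} → Adj G u w → Walk G w v k → Walk G u v (suc k)

Connected : ∀ {n} → Graph n → Set
Connected G = ∀ u v → ∃[ k ] Walk G u v k

data Path {n : ℕ} (G : Graph n) : List (Fin n) → Set where
  one  : ∀ {u} → Path G (u ∷ [])
  cons : ∀ {u w vs} → Adj G u w → Path G (w ∷ vs) → Path G (u ∷ w ∷ vs)

-- A cycle: v₀ v₁ … v_k (k ≥ 2) pairwise distinct, consecutive ones adjacent,
-- and v_k adjacent to v₀.
data Last {A : Set} : List A → A → Set where
  last-one  : ∀ {x} → Last (x ∷ []) x
  last-cons : ∀ {x y ys z} → Last (y ∷ ys) z → Last (x ∷ y ∷ ys) z

record Cycle {n : ℕ} (G : Graph n) : Set where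
  field
    v₀ v₁ v₂ : Fin n
    rest     : List (Fin n)
    vlast    : Fin n
    isLast   : Last (v₀ ∷ v₁ ∷ v₂ ∷ rest) vlast
    distinct : Unique (v₀ ∷ v₁ ∷ v₂ ∷ rest)
    path     : Path G (v₀ ∷ v₁ ∷ v₂ ∷ rest)
    closing  : Adj G vlast v₀

Acyclic : ∀ {n} → Graph n → Set
Acyclic G = ¬ Cycle G

IsTree : ∀ {n} → Graph n → Set
IsTree G = Connected G × Acyclic G

IsDist : ∀ {n} → Graph n → Fin n → Fin n → ℕ → Set
IsDist G u v d = Walk G u v d × (∀ k → Walk G u v k → d ≤ k)

Diam : ∀ {n} → Graph n → ℕ → Set
Diam G d = (∀ u v → ∃[ e ] (IsDist G u v e × e ≤ d))
         × (∃[ u ] ∃[ v ] IsDist G u v d)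

-- Edges of G: unordered pairs {i,j}, represented with i < j.
Edge : ∀ {n} → Graph n → Set
Edge {n} G = Σ (Fin n × Fin n) λ { (i , j) → i < j × Adj G i j }

Endpoint : ∀ {n} (G : Graph n) → Fin n → Edge G → Set
Endpoint G x ((i , j) , _) = (x ≡ i) ⊎ (x ≡ j)

MVertex : ∀ {n} → Graph n → Set
MVertex {n} G = Fin n ⊎ Edge G

MAdj : ∀ {n} (G : Graph n) → MVertex G → MVertex G → Set
MAdj G (inj₁ x) (inj₁ y) = ⊥
MAdj G (inj₁ x) (inj₂ e) = Endpoint G x e
MAdj G (inj₂ e) (inj₁ y) = Endpoint G y e
MAdj G (inj₂ e) (inj₂ f) = e ≢ f × ∃[ x ] (Endpoint G x e × Endpoint G x f)

-- Domination in a graph given by a vertex type and adjacency relation;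
-- sets are duplicate-free lists, cardinality = length.
Dominating : {V : Set} → (V → V → Set) → List V → Set
Dominating {V} R S = ∀ (x : V) → (x ∈ S) ⊎ Any (λ y → R x y) S

IsDominationNumber : {V : Set} → (V → V → Set) → ℕ → Set
IsDominationNumber {V} R k =
  (∃[ S ] (Unique S × Dominating R S × length S ≡ k))
  × (∀ S → Unique S → Dominating R S → k ≤ length S)

module Submission where

-- A tree T of diameter 3 is a double star: the middle edge ab of a longest
-- path u a b v carries two centres, and every other vertex is a leaf hanging
-- from a or from b.  In the middle graph M(T) a leaf x is adjacent only to its
-- pendant edge, so every dominating set contains x or that edge; these n - 2
-- closed neighbourhoods are disjoint, giving γ(M(T)) ≥ n - 2.  Conversely the
-- n - 2 pendant edges cover every vertex of T (a and b are covered through the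
-- leaves u and v), and any edge cover dominates M(T), giving γ(M(T)) ≤ n - 2.

open import Defs
open import Data.Nat using (ℕ; zero; suc; _≤_; _∸_; z≤n; s≤s)
open import Data.Nat.Properties using (≤-refl; ≤-trans; n≤1+n; m≤n⇒m≤1+n)
open import Data.Fin using (Fin; _≟_; punchIn; punchOut) renaming (_<_ to _<ᶠ_)
open import Data.Fin.Properties
  using (<-cmp; <-irrelevant; <-asym; <-irrefl; injective⇒≤;
         punchIn-injective; punchInᵢ≢i; punchIn-punchOut)
import Data.Bool.Properties as Bool
open import Data.Product using (_×_; _,_; ∃-syntax; proj₁; proj₂)
open import Data.Product.Properties using (≡-dec)
open import Data.Sum using (_⊎_; inj₁; inj₂; [_,_]′)
open import Data.Sum.Properties using (inj₁-injective; inj₂-injective)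
open import Data.List using (List; []; _∷_; [_]; _++_; length; map; tabulate; lookup)
open import Data.List.Properties using (length-map; length-tabulate; ∷-injectiveˡ)
open import Data.List.Membership.Propositional using (_∈_; _∉_; find; lose)
open import Data.List.Membership.Propositional.Properties using (∈-map⁺; ∈-++⁻; ∈-tabulate⁺)
open import Data.List.Relation.Binary.Subset.Propositional using (_⊆_)
open import Data.List.Relation.Unary.All using ([]; _∷_)
open import Data.List.Relation.Unary.All.Properties.Core using (¬Any⇒All¬)
open import Data.List.Relation.Unary.AllPairs using ([]; _∷_)
open import Data.List.Relation.Unary.Any using (Any; here; there; index)
open import Data.List.Relation.Unary.Any.Properties using (lookup-index) renaming (map⁺ to any-map⁺)
open import Data.List.Relation.Unary.Unique.Propositional using (Unique)
open import Data.List.Relation.Unary.Unique.Propositional.Properties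
  using (Unique[x∷xs]⇒x∉xs; map⁺; tabulate⁺)
open import Data.Empty using (⊥; ⊥-elim)
open import Function using (Injective)
open import Relation.Binary.Definitions using (DecidableEquality; tri<; tri≈; tri>)
open import Relation.Binary.PropositionalEquality
  using (_≡_; _≢_; ≢-sym; refl; trans; cong; cong₂; subst) renaming (sym to ≡-sym)
open import Relation.Nullary using (yes; no)
open import Relation.Nullary.Decidable using (map′)
open import Axiom.UniquenessOfIdentityProofs using (module Decidable⇒UIP)

fresh-cons : ∀ {A : Set} {x : A} {xs} → x ∉ xs → Unique xs → Unique (x ∷ xs)
fresh-cons x∉xs u = ¬Any⇒All¬ _ x∉xs ∷ u

unique-pair : ∀ {A : Set} {x y : A} → x ≢ y → Unique (x ∷ y ∷ [])
unique-pair x≢y = (x≢y ∷ []) ∷ [] ∷ []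

unique-triple : ∀ {A : Set} {x y z : A} → x ≢ y → x ≢ z → y ≢ z → Unique (x ∷ y ∷ z ∷ [])
unique-triple x≢y x≢z y≢z = (x≢y ∷ x≢z ∷ []) ∷ (y≢z ∷ []) ∷ [] ∷ []

injection-length : ∀ {A : Set} {k} (S : List A) (f : Fin k → A) →
                   Injective _≡_ _≡_ f → (∀ i → f i ∈ S) → k ≤ length S
injection-length S f f-inj f∈S = injective⇒≤ same-position
  where
  same-position : ∀ {i j} → index (f∈S i) ≡ index (f∈S j) → i ≡ j
  same-position {i} {j} eq =
    f-inj (trans (lookup-index (f∈S i))
                 (trans (cong (lookup S) eq) (≡-sym (lookup-index (f∈S j)))))

adj-sym : ∀ {n} (G : Graph n) {x y} → Adj G x y → Adj G y x
adj-sym G = Graph.sym G _ _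

adj-≢ : ∀ {n} (G : Graph n) {x y} → Adj G x y → x ≢ y
adj-≢ G xy refl = irrefl G _ xy

module Routes {n : ℕ} (G : Graph n) where

  open import Data.List.Membership.DecPropositional (_≟_ {n}) using (_∈?_)

  infixr 5 _▸_

  -- Route s t L: a walk from s to t whose vertices after s are, in order, L.
  -- It is simple when s ∷ L is duplicate-free.
  data Route : Fin n → Fin n → List (Fin n) → Set where
    stop : ∀ {s} → Route s s []
    _▸_  : ∀ {s y t L} → Adj G s y → Route y t L → Route s t (y ∷ L)

  route-of-walk : ∀ {s t k} → Walk G s t k → ∃[ L ] (Route s t L × length L ≡ k)
  route-of-walk here = [] , stop , refl
  route-of-walk (step e w) with route-of-walk w
  ... | L , r , len = _ ∷ L , e ▸ r , cong suc len

  route-path : ∀ {s t L} → Route s t L → Path G (s ∷ L)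
  route-path stop    = one
  route-path (e ▸ r) = cons e (route-path r)

  route-last : ∀ {s t L} → Route s t L → Last (s ∷ L) t
  route-last stop    = last-one
  route-last (e ▸ r) = last-cons (route-last r)

  route-end∈ : ∀ {s t y L} → Route s t (y ∷ L) → t ∈ y ∷ L
  route-end∈ (_ ▸ stop)      = here refl
  route-end∈ (_ ▸ r@(_ ▸ _)) = there (route-end∈ r)

  _++ᴿ_ : ∀ {s t r L M} → Route s t L → Route t r M → Route s r (L ++ M)
  stop    ++ᴿ r′ = r′
  (e ▸ r) ++ᴿ r′ = e ▸ (r ++ᴿ r′)

  reverse-route : ∀ {s t L} → Route s t L → ∃[ R ] (Route t s R × R ⊆ s ∷ L)
  reverse-route stop = [] , stop , λ ()
  reverse-route {s} (e ▸ r) with reverse-route r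
  ... | R , r′ , R⊆ = R ++ [ s ] , r′ ++ᴿ (adj-sym G e ▸ stop) , within
    where
    within : R ++ [ s ] ⊆ s ∷ _
    within z∈ with ∈-++⁻ R z∈
    ... | inj₁ z∈R        = there (R⊆ z∈R)
    ... | inj₂ (here z≡s) = here z≡s

  record Shortcut (s t : Fin n) (L : List (Fin n)) : Set where
    constructor shortcut
    field
      vertices : List (Fin n)
      route    : Route s t vertices
      simple   : Unique (s ∷ vertices)
      within   : vertices ⊆ L
      shorter  : length vertices ≤ length L

  enlarge : ∀ {s t K L} → K ⊆ L → length K ≤ length L → Shortcut s t K → Shortcut s t L
  enlarge K⊆L K≤L (shortcut V r u V⊆K V≤K) =
    shortcut V r u (λ z∈ → K⊆L (V⊆K z∈)) (≤-trans V≤K K≤L)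

  suffix : ∀ {s y t K} → Route y t K → Unique (y ∷ K) → s ∈ y ∷ K → Shortcut s t K
  suffix r u (here refl)            = shortcut _ r u (λ z∈ → z∈) ≤-refl
  suffix (_ ▸ r) (_ ∷ u) (there s∈) = enlarge there (n≤1+n _) (suffix r u s∈)

  -- Loop erasure: every route contains a simple route between the same ends.
  shortcut-of : ∀ {s t L} → Route s t L → Shortcut s t L
  shortcut-of stop = shortcut [] stop ([] ∷ []) (λ ()) z≤n
  shortcut-of {s} (_▸_ {y = y} e r) with shortcut-of r
  ... | shortcut K rK uK K⊆ K≤ with s ∈? y ∷ K
  ...   | yes s∈ = enlarge (λ z∈ → there (K⊆ z∈)) (m≤n⇒m≤1+n K≤) (suffix rK uK s∈)
  ...   | no s∉  = shortcut (y ∷ K) (e ▸ rK) (fresh-cons s∉ uK) extend (s≤s K≤)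
    where
    extend : y ∷ K ⊆ y ∷ _
    extend (here z≡y) = here z≡y
    extend (there z∈) = there (K⊆ z∈)

  prefix : ∀ {s t y z L} → Route s t (y ∷ L) → Unique (s ∷ y ∷ L) → z ∈ y ∷ L →
           ∃[ K ] (Route s z (y ∷ K) × Unique (s ∷ y ∷ K) × K ⊆ L)
  prefix (e ▸ _) u (here refl) =
    [] , e ▸ stop , unique-pair (λ s≡y → Unique[x∷xs]⇒x∉xs u (here s≡y)) , λ ()
  prefix (e ▸ stop) u (there ())
  prefix {s} {y = y} (e ▸ r@(_▸_ {y = y′} {L = L′} _ _)) u@(_ ∷ u′) (there z∈)
    with prefix r u′ z∈
  ... | K , rK , uK , K⊆ = y′ ∷ K , e ▸ rK , fresh-cons s∉ uK , y′K⊆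
    where
    y′K⊆ : y′ ∷ K ⊆ y′ ∷ L′
    y′K⊆ (here eq) = here eq
    y′K⊆ (there w) = there (K⊆ w)
    s∉ : s ∉ y ∷ y′ ∷ K
    s∉ (here s≡y) = Unique[x∷xs]⇒x∉xs u (here s≡y)
    s∉ (there w)  = Unique[x∷xs]⇒x∉xs u (there (y′K⊆ w))

  module Forest (acyclic : Acyclic G) where

    -- In an acyclic graph two simple routes with the same ends coincide:
    -- otherwise their first differing steps close a cycle through s.
    simple-route-unique : ∀ {s t P Q} → Route s t P → Unique (s ∷ P) →
                          Route s t Q → Unique (s ∷ Q) → P ≡ Q
    simple-route-unique stop _ stop _ = refl
    simple-route-unique stop _ r@(_ ▸ _) uQ = ⊥-elim (Unique[x∷xs]⇒x∉xs uQ (route-end∈ r))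
    simple-route-unique r@(_ ▸ _) uP stop _ = ⊥-elim (Unique[x∷xs]⇒x∉xs uP (route-end∈ r))
    simple-route-unique {s} (_▸_ {y = p} {L = P′} sp rp) uP (_▸_ {y = q} {L = Q′} sq rq) uQ
      with p ≟ q
    ... | yes refl = cong (p ∷_) (simple-route-unique rp (tail uP) rq (tail uQ))
      where
      tail : ∀ {x xs} → Unique (x ∷ xs) → Unique xs
      tail (_ ∷ u) = u
    ... | no p≢q with reverse-route rq
    ...   | R , tq , R⊆ with shortcut-of (rp ++ᴿ tq)
    ...     | shortcut [] stop _ _ _ = ⊥-elim (p≢q refl)
    ...     | shortcut (c ∷ C) rc uc C⊆ _ = ⊥-elim (acyclic cycle)
      where
      s∉ : s ∉ p ∷ c ∷ C
      s∉ (here s≡p) = Unique[x∷xs]⇒x∉xs uP (here s≡p)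
      s∉ (there w) with ∈-++⁻ P′ (C⊆ w)
      ... | inj₁ s∈P = Unique[x∷xs]⇒x∉xs uP (there s∈P)
      ... | inj₂ s∈R = Unique[x∷xs]⇒x∉xs uQ (R⊆ s∈R)
      cycle : Cycle G
      cycle = record
        { v₀ = s ; v₁ = p ; v₂ = c ; rest = C ; vlast = q
        ; isLast   = last-cons (route-last rc)
        ; distinct = fresh-cons s∉ uc
        ; path     = cons sp (route-path rc)
        ; closing  = adj-sym G sq }

    simple-route-shortest : ∀ {s t L M} → Route s t L → Unique (s ∷ L) →
                            Route s t M → length L ≤ length M
    simple-route-shortest r u r′ with shortcut-of r′
    ... | shortcut K rK uK _ K≤M rewrite simple-route-unique r u rK uK = K≤M

    simple-routes-bounded : ∀ {d} → (∀ s t → ∃[ e ] (IsDist G s t e × e ≤ d)) →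
                            ∀ {s t L} → Route s t L → Unique (s ∷ L) → length L ≤ d
    simple-routes-bounded bounded {s} {t} r u with bounded s t
    ... | e , (w , _) , e≤d with route-of-walk w
    ...   | M , rM , refl = ≤-trans (simple-route-shortest r u rM) e≤d

    -- A neighbour s′ of s other than the next vertex of a simple route from s
    -- avoids the route: otherwise the route up to s′ and the edge s s′ would be
    -- two different simple routes from s to s′.
    prepend : ∀ {s′ s t y L} → Adj G s′ s → Route s t (y ∷ L) → Unique (s ∷ y ∷ L) →
              y ≢ s′ → Unique (s′ ∷ s ∷ y ∷ L)
    prepend {s′} {s} {y = y} {L} s′s r u y≢s′ = fresh-cons s′∉ u
      where
      s′∉ : s′ ∉ s ∷ y ∷ L
      s′∉ (here s′≡s) = adj-≢ G s′s s′≡s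
      s′∉ (there s′∈) with prefix r u s′∈
      ... | K , rK , uK , _ =
        y≢s′ (∷-injectiveˡ (simple-route-unique rK uK (adj-sym G s′s ▸ stop)
                                                 (unique-pair (≢-sym (adj-≢ G s′s)))))

    no-triangle : ∀ {x y z} → Adj G x y → Adj G y z → Adj G x z → ⊥
    no-triangle xy yz xz
      with simple-route-unique (xz ▸ stop) (unique-pair (adj-≢ G xz))
                               (xy ▸ yz ▸ stop) (unique-triple (adj-≢ G xy) (adj-≢ G xz) (adj-≢ G yz))
    ... | ()

    no-square : ∀ {x p q y} → Adj G x p → Adj G p q → Adj G q y → Adj G y x →
                x ≢ q → p ≢ y → ⊥
    no-square xp pq qy yx x≢q p≢y =
      p≢y (∷-injectiveˡ (simple-route-unique
        (xp ▸ pq ▸ stop) (unique-triple (adj-≢ G xp) x≢q (adj-≢ G pq))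
        (adj-sym G yx ▸ adj-sym G qy ▸ stop)
        (unique-triple (≢-sym (adj-≢ G yx)) x≢q (≢-sym (adj-≢ G qy)))))

module Edges {n : ℕ} (G : Graph n) where

  -- An edge is determined by its pair of ends; the order and adjacency proofs are irrelevant.
  edge-ext : ∀ {e f : Edge G} → proj₁ e ≡ proj₁ f → e ≡ f
  edge-ext {ends , lt , adj} {.ends , lt′ , adj′} refl =
    cong₂ (λ l a → _,_ {B = λ { (i , j) → i <ᶠ j × Adj G i j }} ends (l , a))
          (<-irrelevant lt lt′) (Decidable⇒UIP.≡-irrelevant Bool._≟_ adj adj′)

  _≟ᴱ_ : DecidableEquality (Edge G)
  e ≟ᴱ f = map′ edge-ext (cong proj₁) (≡-dec _≟_ _≟_ (proj₁ e) (proj₁ f))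

  ends-determined : ∀ {x y} (e : Edge G) → x <ᶠ y → Endpoint G x e → Endpoint G y e →
                    proj₁ e ≡ (x , y)
  ends-determined _ x<y (inj₁ refl) (inj₂ refl) = refl
  ends-determined _ x<x (inj₁ refl) (inj₁ refl) = ⊥-elim (<-irrefl refl x<x)
  ends-determined _ x<x (inj₂ refl) (inj₂ refl) = ⊥-elim (<-irrefl refl x<x)
  ends-determined (_ , i<j , _) j<i (inj₂ refl) (inj₁ refl) = ⊥-elim (<-asym i<j j<i)

  edge-unique : ∀ {x y} {e f : Edge G} → x ≢ y → Endpoint G x e → Endpoint G y e →
                Endpoint G x f → Endpoint G y f → e ≡ f
  edge-unique {x} {y} {e} {f} x≢y xe ye xf yf with <-cmp x y
  ... | tri< x<y _ _ = edge-ext (trans (ends-determined e x<y xe ye) (≡-sym (ends-determined f x<y xf yf)))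
  ... | tri≈ _ x≡y _ = ⊥-elim (x≢y x≡y)
  ... | tri> _ _ y<x = edge-ext (trans (ends-determined e y<x ye xe) (≡-sym (ends-determined f y<x yf xf)))

  other-end : ∀ {x} (e : Edge G) → Endpoint G x e → ∃[ y ] (Endpoint G y e × Adj G x y)
  other-end ((i , j) , _ , ij) (inj₁ refl) = j , inj₂ refl , ij
  other-end ((i , j) , _ , ij) (inj₂ refl) = i , inj₁ refl , adj-sym G ij

  edge-between : ∀ {x y} → Adj G x y → Edge G
  edge-between {x} {y} xy with <-cmp x y
  ... | tri< x<y _ _ = (x , y) , x<y , xy
  ... | tri≈ _ x≡y _ = ⊥-elim (adj-≢ G xy x≡y)
  ... | tri> _ _ y<x = (y , x) , y<x , adj-sym G xy

  between-ends : ∀ {x y z} (xy : Adj G x y) → z ≡ x ⊎ z ≡ y → Endpoint G z (edge-between xy)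
  between-ends {x} {y} xy z-end with <-cmp x y
  ... | tri< _ _ _ = z-end
  ... | tri≈ _ x≡y _ = ⊥-elim (adj-≢ G xy x≡y)
  ... | tri> _ _ _ = [ inj₂ , inj₁ ]′ z-end

  between-only : ∀ {x y z} (xy : Adj G x y) → Endpoint G z (edge-between xy) → z ≡ x ⊎ z ≡ y
  between-only {x} {y} xy z-end with <-cmp x y
  ... | tri< _ _ _ = z-end
  ... | tri≈ _ x≡y _ = ⊥-elim (adj-≢ G xy x≡y)
  ... | tri> _ _ _ = [ inj₂ , inj₁ ]′ z-end

  PendantEdge : Fin n → Edge G → Set
  PendantEdge x e = Endpoint G x e × (∀ f → Endpoint G x f → f ≡ e)

  pendant-edge : ∀ {x p} (xp : Adj G x p) → (∀ y → Adj G x y → y ≡ p) →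
                 PendantEdge x (edge-between xp)
  pendant-edge {x} {p} xp only = between-ends xp (inj₁ refl) , edge-at-x
    where
    edge-at-x : ∀ f → Endpoint G x f → f ≡ edge-between xp
    edge-at-x f xf with other-end f xf
    ... | y , yf , xy = edge-unique (adj-≢ G xp) xf (subst (λ z → Endpoint G z f) (only y xy) yf)
                                    (between-ends xp (inj₁ refl)) (between-ends xp (inj₂ refl))

module MiddleGraphDomination {n : ℕ} (G : Graph n) where

  open Edges G

  -- In M(G) a vertex x with pendant edge e is adjacent to e only, so every
  -- dominating set contains x or e.
  pendant-dominated : ∀ {S x e} → Dominating (MAdj G) S → PendantEdge x e →
                      inj₁ x ∈ S ⊎ inj₂ e ∈ S
  pendant-dominated {S} {x} dom (_ , only) with dom (inj₁ x)
  ... | inj₁ x∈S = inj₁ x∈S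
  ... | inj₂ near with find near
  ...   | inj₂ f , f∈S , xf = inj₂ (subst (λ g → inj₂ g ∈ S) (only f xf) f∈S)

  -- Leaves ι i with pairwise distinct pendant edges E i: every dominating set
  -- of M(G) meets the disjoint sets {ι i , E i}, so it has at least m elements.
  pendant-lower-bound : ∀ {m} {ι : Fin m → Fin n} {E : Fin m → Edge G} →
                        Injective _≡_ _≡_ E → (∀ i → PendantEdge (ι i) (E i)) →
                        ∀ S → Dominating (MAdj G) S → m ≤ length S
  pendant-lower-bound {m} {ι} {E} E-inj pendant S dom =
    injection-length S (λ i → proj₁ (chosen i)) chosen-injective (λ i → proj₁ (proj₂ (chosen i)))
    where
    Near : Fin m → MVertex G → Set
    Near i w = w ≡ inj₁ (ι i) ⊎ w ≡ inj₂ (E i)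

    chosen : ∀ i → ∃[ w ] (w ∈ S × Near i w)
    chosen i with pendant-dominated dom (pendant i)
    ... | inj₁ ι∈S = _ , ι∈S , inj₁ refl
    ... | inj₂ E∈S = _ , E∈S , inj₂ refl

    -- Distinct leaves are distinct vertices, since their pendant edges differ.
    ι-injective : ∀ {i j} → ι i ≡ ι j → i ≡ j
    ι-injective {i} {j} eq =
      E-inj (proj₂ (pendant j) (E i) (subst (λ z → Endpoint G z (E i)) eq (proj₁ (pendant i))))

    separate : ∀ {i j w} → Near i w → Near j w → i ≡ j
    separate (inj₁ refl) (inj₁ eq) = ι-injective (inj₁-injective eq)
    separate (inj₁ refl) (inj₂ ())
    separate (inj₂ refl) (inj₁ ())
    separate (inj₂ refl) (inj₂ eq) = E-inj (inj₂-injective eq)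

    chosen-injective : ∀ {i j} → proj₁ (chosen i) ≡ proj₁ (chosen j) → i ≡ j
    chosen-injective {i} {j} eq =
      separate (proj₂ (proj₂ (chosen i)))
               (subst (Near j) (≡-sym eq) (proj₂ (proj₂ (chosen j))))

  edge-cover-dominates : (C : List (Edge G)) → (∀ x → Any (Endpoint G x) C) →
                         Dominating (MAdj G) (map inj₂ C)
  edge-cover-dominates C cover (inj₁ x) = inj₂ (any-map⁺ (cover x))
  edge-cover-dominates C cover (inj₂ f@((c , _) , _)) with find (cover c)
  ... | e , e∈C , ce with f ≟ᴱ e
  ...   | yes refl = inj₁ (∈-map⁺ inj₂ e∈C)
  ...   | no f≢e   = inj₂ (any-map⁺ (lose e∈C (f≢e , c , inj₁ refl , ce)))

-- The elements of Fin (2 + m) other than two distinct a and b, listed without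
-- repetition by Fin m.
module AllBut {m : ℕ} {a b : Fin (suc (suc m))} (a≢b : a ≢ b) where

  private
    b′ : Fin (suc m)
    b′ = punchOut a≢b

  others : Fin m → Fin (suc (suc m))
  others i = punchIn a (punchIn b′ i)

  others-injective : ∀ {i j} → others i ≡ others j → i ≡ j
  others-injective eq = punchIn-injective b′ _ _ (punchIn-injective a _ _ eq)

  others≢a : ∀ i → others i ≢ a
  others≢a i = punchInᵢ≢i a _

  others≢b : ∀ i → others i ≢ b
  others≢b i eq =
    punchInᵢ≢i b′ i (punchIn-injective a _ _ (trans eq (≡-sym (punchIn-punchOut a≢b))))

  others-onto : ∀ {x} → x ≢ a → x ≢ b → ∃[ i ] (others i ≡ x)
  others-onto {x} x≢a x≢b =
    punchOut b′≢x′ , trans (cong (punchIn a) (punchIn-punchOut b′≢x′)) (punchIn-punchOut a≢x)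
    where
    a≢x : a ≢ x
    a≢x = ≢-sym x≢a
    x′ : Fin (suc m)
    x′ = punchOut a≢x
    b′≢x′ : b′ ≢ x′
    b′≢x′ eq = x≢b (trans (≡-sym (punchIn-punchOut a≢x))
                          (trans (cong (punchIn a) (≡-sym eq)) (punchIn-punchOut a≢b)))

-- A tree whose simple routes have length at most 3 and which contains a route
-- u a b v with u ≠ b and a ≠ v is a double star with centres a and b.
module DoubleStar {n : ℕ} (T : Graph n) (conn : Connected T) (acyclic : Acyclic T)
  (short : ∀ {s t L} → Routes.Route T s t L → Unique (s ∷ L) → length L ≤ 3)
  {u a b v : Fin n} (ua : Adj T u a) (ab : Adj T a b) (bv : Adj T b v)
  (u≢b : u ≢ b) (a≢v : a ≢ v) where

  open Routes T
  open Forest acyclic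

  -- Every vertex is a centre or adjacent to a centre.  Otherwise the simple
  -- route from a to it, extended by u or by v b, would have length ≥ 4.
  classify : ∀ x → x ≡ a ⊎ x ≡ b ⊎ Adj T x a ⊎ Adj T x b
  classify x with conn a x
  ... | _ , w with route-of-walk w
  ...   | _ , r , _ with shortcut-of r
  ...     | shortcut _ rK uK _ _ = from-route rK uK
    where
    too-long : ∀ {s t y₁ y₂ y₃ y₄ L} → Route s t (y₁ ∷ y₂ ∷ y₃ ∷ y₄ ∷ L) →
               Unique (s ∷ y₁ ∷ y₂ ∷ y₃ ∷ y₄ ∷ L) → ⊥
    too-long r u with short r u
    ... | s≤s (s≤s (s≤s ()))

    from-route : ∀ {K} → Route a x K → Unique (a ∷ K) → x ≡ a ⊎ x ≡ b ⊎ Adj T x a ⊎ Adj T x b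
    from-route stop _ = inj₁ refl
    from-route (ay ▸ stop) _ = inj₂ (inj₂ (inj₁ (adj-sym T ay)))
    from-route {y ∷ _ ∷ _} r uK with y ≟ b
    ... | no y≢b =
      ⊥-elim (too-long (vb ▸ ba ▸ r) (prepend vb (ba ▸ r) (prepend ba r uK y≢b) a≢v))
      where
      ba = adj-sym T ab
      vb = adj-sym T bv
    from-route (_ ▸ bz ▸ stop) _ | yes refl = inj₂ (inj₂ (inj₂ (adj-sym T bz)))
    from-route r@(_ ▸ _ ▸ _ ▸ _) uK | yes refl =
      ⊥-elim (too-long (ua ▸ r) (prepend ua r uK (≢-sym u≢b)))

  -- A vertex other than b adjacent to a is a leaf: a is its only neighbour,
  -- since any other neighbour would close a triangle or a 4-cycle.
  leaf-of-a : ∀ {x} → x ≢ b → Adj T x a → ∀ y → Adj T x y → y ≡ a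
  leaf-of-a x≢b xa y xy with y ≟ a
  ... | yes y≡a = y≡a
  ... | no y≢a with classify y
  ...   | inj₁ y≡a = y≡a
  ...   | inj₂ (inj₁ refl) = ⊥-elim (no-triangle xa ab xy)
  ...   | inj₂ (inj₂ (inj₁ ya)) = ⊥-elim (no-triangle xy ya xa)
  ...   | inj₂ (inj₂ (inj₂ yb)) =
    ⊥-elim (no-square xa ab (adj-sym T yb) (adj-sym T xy) x≢b (≢-sym y≢a))

-- The middle graph of a double star on 2 + m vertices has domination number m:
-- its m pendant edges are a minimum dominating set.
module DoubleStarDomination {m : ℕ} (T : Graph (suc (suc m)))
  (conn : Connected T) (acyclic : Acyclic T)
  (short : ∀ {s t L} → Routes.Route T s t L → Unique (s ∷ L) → length L ≤ 3)
  {u a b v : Fin (suc (suc m))} (ua : Adj T u a) (ab : Adj T a b) (bv : Adj T b v)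
  (u≢b : u ≢ b) (a≢v : a ≢ v) where

  open Edges T
  open MiddleGraphDomination T
  open AllBut (adj-≢ T ab)

  -- The same double star seen from either end of the route u a b v.
  module FromA = DoubleStar T conn acyclic short ua ab bv u≢b a≢v
  module FromB = DoubleStar T conn acyclic short
                   (adj-sym T bv) (adj-sym T ab) (adj-sym T ua) (≢-sym a≢v) (≢-sym u≢b)

  record Leaf (x : Fin (suc (suc m))) : Set where
    field
      centre    : Fin (suc (suc m))
      is-centre : centre ≡ a ⊎ centre ≡ b
      to-centre : Adj T x centre
      only      : ∀ y → Adj T x y → y ≡ centre

  leaf : ∀ {x} → x ≢ a → x ≢ b → Leaf x
  leaf x≢a x≢b with FromA.classify _
  ... | inj₁ x≡a = ⊥-elim (x≢a x≡a)
  ... | inj₂ (inj₁ x≡b) = ⊥-elim (x≢b x≡b)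
  ... | inj₂ (inj₂ (inj₁ xa)) = record
    { centre = a ; is-centre = inj₁ refl ; to-centre = xa ; only = FromA.leaf-of-a x≢b xa }
  ... | inj₂ (inj₂ (inj₂ xb)) = record
    { centre = b ; is-centre = inj₂ refl ; to-centre = xb ; only = FromB.leaf-of-a x≢a xb }

  leaf-at : ∀ i → Leaf (others i)
  leaf-at i = leaf (others≢a i) (others≢b i)

  pendant : Fin m → Edge T
  pendant i = edge-between (Leaf.to-centre (leaf-at i))

  pendant-is-pendant : ∀ i → PendantEdge (others i) (pendant i)
  pendant-is-pendant i = pendant-edge (Leaf.to-centre (leaf-at i)) (Leaf.only (leaf-at i))

  -- Distinct leaves have distinct pendant edges: the leaf others i cannot be
  -- the centre end of the pendant edge of others j.
  pendant-injective : ∀ {i j} → pendant i ≡ pendant j → i ≡ j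
  pendant-injective {i} {j} eq
    with between-only (Leaf.to-centre (leaf-at j))
                      (subst (Endpoint T (others i)) eq (proj₁ (pendant-is-pendant i)))
  ... | inj₁ same = others-injective same
  ... | inj₂ at-centre = ⊥-elim
    ([ (λ c≡a → others≢a i (trans at-centre c≡a)) , (λ c≡b → others≢b i (trans at-centre c≡b)) ]′
       (Leaf.is-centre (leaf-at j)))

  pendants : List (Edge T)
  pendants = tabulate pendant

  covered-via-leaf : ∀ {x c} → x ≢ a → x ≢ b → Adj T x c → Any (Endpoint T c) pendants
  covered-via-leaf x≢a x≢b xc with others-onto x≢a x≢b
  ... | i , refl = lose (∈-tabulate⁺ i)
    (subst (λ z → Endpoint T z (pendant i)) (≡-sym (Leaf.only (leaf-at i) _ xc))
           (between-ends (Leaf.to-centre (leaf-at i)) (inj₂ refl)))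

  -- The pendant edges cover all vertices: the centres through the leaves u and v.
  pendants-cover : ∀ x → Any (Endpoint T x) pendants
  pendants-cover x with x ≟ a | x ≟ b
  ... | yes refl | _ = covered-via-leaf (adj-≢ T ua) u≢b ua
  ... | no _ | yes refl = covered-via-leaf (≢-sym a≢v) (≢-sym (adj-≢ T bv)) (adj-sym T bv)
  ... | no x≢a | no x≢b with others-onto x≢a x≢b
  ...   | i , refl = lose (∈-tabulate⁺ i) (proj₁ (pendant-is-pendant i))

  domination-number : IsDominationNumber (MAdj T) m
  domination-number =
    ( map inj₂ pendants
    , map⁺ inj₂-injective (tabulate⁺ pendant-injective)
    , edge-cover-dominates pendants pendants-cover
    , trans (length-map inj₂ pendants) (length-tabulate pendant) )
    , λ S _ dom → pendant-lower-bound pendant-injective pendant-is-pendant S dom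

-- A tree of order n ≥ 4 and diameter 3 has γ(M(T)) = n - 2.  A pair at distance
-- 3 yields the route u a b v, with u ≠ b and a ≠ v because the distance is not 1.
theorem2p5 : (n : ℕ) → (T : Graph n) → 4 ≤ n → IsTree T → Diam T 3 →
    IsDominationNumber (MAdj T) (n ∸ 2)
theorem2p5 zero T () _ _
theorem2p5 (suc zero) T (s≤s ()) _ _
theorem2p5 (suc (suc m)) T _ (conn , acyclic)
           (bounded , u , v , step {w = a} ua (step {w = b} ab (step bv here)) , minimal) =
  DoubleStarDomination.domination-number T conn acyclic
    (Routes.Forest.simple-routes-bounded T acyclic bounded) ua ab bv u≢b a≢v
  where
  u≢b : u ≢ b
  u≢b refl with minimal 1 (step bv here)
  ... | s≤s ()
  a≢v : a ≢ v
  a≢v refl with minimal 1 (step ua here)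
  ... | s≤s ()
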